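{- Let $p>2$ be prime. For $n\ge3$ let $R_2(n)=X_1X_2+X_2X_3+\cdots+X_{n-1}X_n+X_nX_1\in\mathbb{F}_p[X_1,\dots,X_n]$. Then the sequence $\{S_{\mathbb{F}_p}(R_2(n))\}$ satisfies the homogeneous linear recurrence with characteristic polynomial $Q_{R,2,\mathbb{F}_p}(X)=X^4-p^2$, i.e. $S_{\mathbb{F}_p}(R_2(n))=p^2S_{\mathbb{F}_p}(R_2(n-4))$.
   Context: For $F\in\mathbb{F}_p[X_1,\dots,X_n]$, $S_{\mathbb{F}_p}(F)=\sum_{\mathbf{x}\in\mathbb{F}_p^n}e^{\frac{2\pi i}{p}F(\mathbf{x})}$ (with $F(\mathbf{x})$ viewed as an integer mod $p$). -}

module Defs where

open import Data.Nat using (ℕ; zero; suc; _+_; _*_; _%_; NonZero)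
open import Data.Nat.Properties using (_≟_)
open import Data.Fin using (Fin; toℕ)
open import Data.Vec using (Vec; []; _∷_; toList)
open import Data.List as List using (List; []; _∷_; _++_; take; concatMap; allFin)
open import Data.Integer as ℤ using (ℤ; +_)
open import Data.Product using (∃)
open import Relation.Binary.PropositionalEquality using (_≡_)
open import Relation.Nullary.Decidable using (does)
open import Data.Bool using (if_then_else_)

-- The cyclotomic ring ℤ[ζ_p] (ζ_p = e^{2πi/p}, p prime), realised as
-- ℤ[X]/(X^p - 1) modulo 1 + X + ... + X^{p-1}: an element is a coefficient
-- vector c, standing for Σ_a c(a) ζ_p^a.  Since 1 + ζ + ... + ζ^{p-1} = 0 is
-- the only relation (p prime), two vectors denote the same complex number iff
-- their difference is a constant vector.
Cyc : ℕ → Set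
Cyc p = Fin p → ℤ

_≈ᶜ_ : ∀ {p} → Cyc p → Cyc p → Set
c ≈ᶜ d = ∃ λ (k : ℤ) → ∀ a → c a ℤ.- d a ≡ k

zeroᶜ : ∀ {p} → Cyc p
zeroᶜ _ = + 0

_+ᶜ_ : ∀ {p} → Cyc p → Cyc p → Cyc p
(c +ᶜ d) a = c a ℤ.+ d a

_·ᶜ_ : ∀ {p} → ℤ → Cyc p → Cyc p
(k ·ᶜ c) a = k ℤ.* c a

-- e(k) = e^{2πi k / p} = ζ_p^(k mod p), for an integer value k ≥ 0
ePow : (p : ℕ) .{{_ : NonZero p}} → ℕ → Cyc p
ePow p k a = if does ((k % p) ≟ toℕ a) then + 1 else + 0

points : (p n : ℕ) → List (Vec (Fin p) n)
points p zero = [] ∷ []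
points p (suc n) = concatMap (λ v → List.map (_∷ v) (allFin p)) (points p n)

sumᶜ : ∀ {p} → List (Cyc p) → Cyc p
sumᶜ = List.foldr _+ᶜ_ zeroᶜ

-- S_{𝔽_p}(F) = Σ_{x ∈ 𝔽_p^n} e^{2πi F(x)/p}, where F is given by its
-- integer-valued evaluation (a polynomial with integer coefficients
-- evaluated at the representatives 0..p-1, then reduced mod p by ePow).
S : (p : ℕ) .{{_ : NonZero p}} (n : ℕ) → (Vec (Fin p) n → ℕ) → Cyc p
S p n F = sumᶜ (List.map (λ x → ePow p (F x)) (points p n))

adj : List ℕ → ℕ
adj (a ∷ b ∷ r) = a * b + adj (b ∷ r)
adj _ = 0

R2 : ∀ {p} (n : ℕ) → Vec (Fin p) n → ℕ
R2 n x = adj (xs ++ take 1 xs)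
  where xs = List.map toℕ (toList x)

-- Write N = n + 4. In R₂(N) the variable x₁ occurs only in x₁(x₂ + x_N), so Σ_{x₁} ζ^{x₁(x₂ + x_N)}
-- is p when x₂ ≡ −x_N (mod p) and otherwise the sum of all p-th roots of unity, i.e. 0. Summing
-- over (x₁, x₂) thus contributes a factor p and sets x₂ = −x_N, which leaves the form
-- x₃(x₄ − x_N) + x₄x₅ + ⋯ + x_{N−1}x_N. Now x₃ occurs only in x₃(x₄ − x_N), and summing over
-- (x₃, x₄) contributes another p and sets x₄ = x_N, leaving R₂(n) in the variables x₅, …, x_N.
module Submission where

open import Defs
open import Algebra.Bundles using (CommutativeMonoid)
import Algebra.Properties.CommutativeMonoid.Sum as CommutativeMonoidSum
open import Data.Bool using (if_then_else_)
open import Data.Empty using (⊥-elim)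
open import Data.Fin as Fin using (Fin; toℕ; fromℕ<; punchIn; punchOut)
open import Data.Fin.Patterns using (0F)
open import Data.Fin.Properties
  using (any?; toℕ-injective; toℕ<n; toℕ-fromℕ<; punchInᵢ≢i; punchOut-injective; injective⇒≤)
open import Data.Integer as ℤ using (+_)
import Data.Integer.Properties as ℤ
import Data.Integer.Tactic.RingSolver as ℤ-Solver
open import Data.List as List using (List; []; _∷_; _++_; allFin; concat)
import Data.List.Properties as List
open import Data.Nat using (ℕ; zero; suc; _+_; _*_; _∸_; _^_; _%_; _/_; _≤_; _<_; NonZero; nonTrivial⇒≢1)
open import Data.Nat.DivMod using (m%n<n; m≡m%n+[m/n]*n; m<n⇒m%n≡m; n%n≡0; %-remove-+ˡ)
open import Data.Nat.Divisibility using (_∣_; _∤_; divides; ∣m+n∣m⇒∣n; n∣m*n; ∣n⇒∣m*n; ∣1⇒≡1; m%n≡0⇒n∣m; n∣m⇒m%n≡0)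
open import Data.Nat.Primality using (Prime; euclidsLemma; prime⇒nonTrivial)
open import Data.Nat.Properties as ℕ using (≤-total; ≤-antisym; m∸n≡0⇒m≤n; m+[n∸m]≡n; m∸n≤m; 1+n≰n)
import Data.Nat.Tactic.RingSolver as ℕ-Solver
open import Data.Product using (∃; _,_; proj₁; proj₂)
open import Data.Sum using (inj₁; inj₂)
open import Data.Vec as Vec using (Vec; []; _∷_; toList; last)
open import Data.Vec.Functional using (Vector; removeAt; tail)
open import Function using (_∘_)
open import Function.Definitions using (Injective)
open import Level using (0ℓ)
open import Relation.Binary.PropositionalEquality as ≡ using (_≡_; _≢_; _≗_; cong; cong₂; subst)
open import Relation.Nullary using (yes; no; contradiction)
open import Relation.Nullary.Decidable using (does; dec-true; dec-false)

sum-collapse : ∀ {c ℓ} (M : CommutativeMonoid c ℓ) → let open CommutativeMonoid M in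
  ∀ {n} (t : Vector Carrier n) i → (∀ j → j ≢ i → t j ≈ ε) →
  CommutativeMonoidSum.sum M t ≈ t i
sum-collapse M {suc n} t i t≈ε = begin
  sum t                      ≈⟨ sum-remove t ⟩
  t i ∙ sum (removeAt t i)   ≈⟨ ∙-congˡ (trans (sum-cong-≋ off-i) (sum-replicate-zero n)) ⟩
  t i ∙ ε                    ≈⟨ identityʳ (t i) ⟩
  t i                        ∎
  where
  open CommutativeMonoid M
  open CommutativeMonoidSum M
  open import Relation.Binary.Reasoning.Setoid setoid
  off-i : ∀ j → t (punchIn i j) ≈ ε
  off-i j = t≈ε (punchIn i j) (punchInᵢ≢i i j)

injective⇒surjective : ∀ {n} {f : Fin n → Fin n} → Injective _≡_ _≡_ f → ∀ y → ∃ λ x → f x ≡ y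
injective⇒surjective {suc n} {f} f-injective y with any? (λ x → f x Fin.≟ y)
... | yes hit = hit
... | no ¬hit = contradiction (injective⇒≤ squeezed-injective) 1+n≰n
  where
  y≢f : ∀ x → y ≢ f x
  y≢f x y≡fx = ¬hit (x , ≡.sym y≡fx)
  squeezed : Fin (suc n) → Fin n
  squeezed x = punchOut (y≢f x)
  squeezed-injective : Injective _≡_ _≡_ squeezed
  squeezed-injective {x} {x′} = f-injective ∘ punchOut-injective (y≢f x) (y≢f x′)

[m+n]%d≡m%d⇒d∣n : ∀ m n d .{{_ : NonZero d}} → (m + n) % d ≡ m % d → d ∣ n
[m+n]%d≡m%d⇒d∣n m n d eq = ∣m+n∣m⇒∣n (divides ((m + n) / d) (ℕ.+-cancelˡ-≡ (m % d) _ _ lemma)) (n∣m*n (m / d))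
  where
  open ≡.≡-Reasoning
  lemma : m % d + ((m / d) * d + n) ≡ m % d + ((m + n) / d) * d
  lemma = begin
    m % d + ((m / d) * d + n)        ≡⟨ ℕ.+-assoc (m % d) _ n ⟨
    m % d + (m / d) * d + n          ≡⟨ cong (_+ n) (m≡m%n+[m/n]*n m d) ⟨
    m + n                            ≡⟨ m≡m%n+[m/n]*n (m + n) d ⟩
    (m + n) % d + ((m + n) / d) * d  ≡⟨ cong (_+ ((m + n) / d) * d) eq ⟩
    m % d + ((m + n) / d) * d        ∎

module Residues (p : ℕ) .{{_ : NonZero p}} (p-prime : Prime p) where

  p∤1 : p ∤ 1
  p∤1 = nonTrivial⇒≢1 {{prime⇒nonTrivial p-prime}} ∘ ∣1⇒≡1

  private
    affine-injective-≤ : ∀ {i j d} r → p ∤ d → i ≤ j → j < p →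
      (i * d + r) % p ≡ (j * d + r) % p → i ≡ j
    affine-injective-≤ {i} {j} {d} r p∤d i≤j j<p eq
      with euclidsLemma (j ∸ i) d p-prime ([m+n]%d≡m%d⇒d∣n (i * d + r) ((j ∸ i) * d) p shifted)
      where
      shifted : (i * d + r + (j ∸ i) * d) % p ≡ (i * d + r) % p
      shifted = begin
        (i * d + r + (j ∸ i) * d) % p  ≡⟨ cong (_% p) (regroup i (j ∸ i) d r) ⟩
        ((i + (j ∸ i)) * d + r) % p    ≡⟨ cong (λ k → (k * d + r) % p) (m+[n∸m]≡n i≤j) ⟩
        (j * d + r) % p                ≡⟨ eq ⟨
        (i * d + r) % p                ∎
        where
        open ≡.≡-Reasoning
        regroup : ∀ a b d r → a * d + r + b * d ≡ (a + b) * d + r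
        regroup = ℕ-Solver.solve-∀
    ... | inj₂ p∣d = ⊥-elim (p∤d p∣d)
    ... | inj₁ p∣j∸i = ≤-antisym i≤j (m∸n≡0⇒m≤n j∸i≡0)
      where
      j∸i≡0 : j ∸ i ≡ 0
      j∸i≡0 = ≡.trans (≡.sym (m<n⇒m%n≡m (ℕ.≤-<-trans (m∸n≤m j i) j<p))) (n∣m⇒m%n≡0 _ p p∣j∸i)

  affine-injective : ∀ {d} r → p ∤ d → ∀ {x y : Fin p} →
    (toℕ x * d + r) % p ≡ (toℕ y * d + r) % p → x ≡ y
  affine-injective r p∤d {x} {y} eq with ≤-total (toℕ x) (toℕ y)
  ... | inj₁ x≤y = toℕ-injective (affine-injective-≤ r p∤d x≤y (toℕ<n y) eq)
  ... | inj₂ y≤x = toℕ-injective (≡.sym (affine-injective-≤ r p∤d y≤x (toℕ<n x) (≡.sym eq)))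

  residue-surjective : (f : Fin p → ℕ) → (∀ {x y} → f x % p ≡ f y % p → x ≡ y) →
    ∀ k → ∃ λ x → f x % p ≡ k % p
  residue-surjective f f-injective k = let x , fx≡k = injective⇒surjective reduce-injective (reduce k) in
    x , ≡.trans (≡.sym (toℕ-fromℕ< _)) (≡.trans (cong toℕ fx≡k) (toℕ-fromℕ< _))
    where
    reduce : ℕ → Fin p
    reduce k = fromℕ< (m%n<n k p)
    reduce-injective : Injective _≡_ _≡_ (reduce ∘ f)
    reduce-injective eq =
      f-injective (≡.trans (≡.sym (toℕ-fromℕ< _)) (≡.trans (cong toℕ eq) (toℕ-fromℕ< _)))

  translate-injective : ∀ c {x y : Fin p} → (toℕ x + c) % p ≡ (toℕ y + c) % p → x ≡ y
  translate-injective c {x} {y} eq = affine-injective c p∤1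
    (≡.trans (cong (λ k → (k + c) % p) (ℕ.*-identityʳ (toℕ x)))
      (≡.trans eq (cong (λ k → (k + c) % p) (≡.sym (ℕ.*-identityʳ (toℕ y))))))

  negation : ∀ c → ∃ λ (a : Fin p) → p ∣ toℕ a + c
  negation c = let a , a+c≡p = residue-surjective (λ x → toℕ x + c) (translate-injective c) p in
    a , m%n≡0⇒n∣m _ p (≡.trans a+c≡p (n%n≡0 p))

  negation-unique : ∀ c {x y : Fin p} → p ∣ toℕ x + c → p ∣ toℕ y + c → x ≡ y
  negation-unique c p∣x+c p∣y+c =
    translate-injective c (≡.trans (n∣m⇒m%n≡0 _ p p∣x+c) (≡.sym (n∣m⇒m%n≡0 _ p p∣y+c)))

adj-∷ʳ : ∀ {A : Set} {m} (f : A → ℕ) (v : Vec A (suc m)) z →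
  adj (List.map f (toList v) ++ z ∷ []) ≡ adj (List.map f (toList v)) + f (last v) * z
adj-∷ʳ f (a ∷ []) z = ℕ.+-identityʳ (f a * z)
adj-∷ʳ f (a ∷ b ∷ w) z = ≡.trans (cong (_+_ (f a * f b)) (adj-∷ʳ f (b ∷ w) z)) (≡.sym (ℕ.+-assoc (f a * f b) _ _))

chain : ∀ {p m} → Vec (Fin p) m → ℕ
chain v = adj (List.map toℕ (toList v))

R2≡last*head+chain : ∀ {p m} (v : Vec (Fin p) (suc m)) → R2 _ v ≡ toℕ (last v) * toℕ (Vec.head v) + chain v
R2≡last*head+chain (y ∷ w) = ≡.trans (adj-∷ʳ toℕ (y ∷ w) (toℕ y)) (ℕ.+-comm (chain (y ∷ w)) _)

R2-peel : ∀ {p m} (x₁ x₂ x₃ x₄ : Fin p) (v : Vec (Fin p) (suc m)) →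
  R2 _ (x₁ ∷ x₂ ∷ x₃ ∷ x₄ ∷ v) ≡
    toℕ x₁ * (toℕ x₂ + toℕ (last v)) + (toℕ x₃ * (toℕ x₄ + toℕ x₂) + (toℕ x₄ * toℕ (Vec.head v) + chain v))
R2-peel x₁ x₂ x₃ x₄ v@(y ∷ _) =
  ≡.trans (cong (λ s → t₁ * t₂ + (t₂ * t₃ + (t₃ * t₄ + (t₄ * toℕ y + s)))) (adj-∷ʳ toℕ v t₁))
          (regroup t₁ t₂ t₃ t₄ (toℕ y) (chain v) (toℕ (last v)))
  where
  t₁ = toℕ x₁; t₂ = toℕ x₂; t₃ = toℕ x₃; t₄ = toℕ x₄
  regroup : ∀ t₁ t₂ t₃ t₄ u A l →
    t₁ * t₂ + (t₂ * t₃ + (t₃ * t₄ + (t₄ * u + (A + l * t₁)))) ≡ t₁ * (t₂ + l) + (t₃ * (t₄ + t₂) + (t₄ * u + A))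
  regroup = ℕ-Solver.solve-∀

module _ {p : ℕ} where

  ≗⇒≈ᶜ : {c d : Cyc p} → c ≗ d → c ≈ᶜ d
  ≗⇒≈ᶜ {c} {d} c≗d = + 0 , λ a → ≡.trans (cong (λ z → c a ℤ.- z) (≡.sym (c≗d a))) (ℤ.+-inverseʳ (c a))

  private
    differences : ∀ a b c d → (a ℤ.+ b) ℤ.- (c ℤ.+ d) ≡ (a ℤ.- c) ℤ.+ (b ℤ.- d)
    differences = ℤ-Solver.solve-∀

    telescope : ∀ a b c → a ℤ.- c ≡ (a ℤ.- b) ℤ.+ (b ℤ.- c)
    telescope = ℤ-Solver.solve-∀

    flip-difference : ∀ a b → b ℤ.- a ≡ ℤ.- (a ℤ.- b)
    flip-difference = ℤ-Solver.solve-∀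

    scale-difference : ∀ k a b → k ℤ.* a ℤ.- k ℤ.* b ≡ k ℤ.* (a ℤ.- b)
    scale-difference = ℤ-Solver.solve-∀

  ≈ᶜ-trans : {c d e : Cyc p} → c ≈ᶜ d → d ≈ᶜ e → c ≈ᶜ e
  ≈ᶜ-trans {c} {d} {e} (k , c-d≡k) (l , d-e≡l) =
    k ℤ.+ l , λ a → ≡.trans (telescope (c a) (d a) (e a)) (cong₂ ℤ._+_ (c-d≡k a) (d-e≡l a))

  Cyc-commutativeMonoid : CommutativeMonoid 0ℓ 0ℓ
  Cyc-commutativeMonoid = record
    { Carrier = Cyc p
    ; _≈_ = _≈ᶜ_
    ; _∙_ = _+ᶜ_
    ; ε = zeroᶜ
    ; isCommutativeMonoid = record
      { isMonoid = record
        { isSemigroup = record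
          { isMagma = record
            { isEquivalence = record
              { refl = λ {c} → ≗⇒≈ᶜ {c} {c} (λ _ → ≡.refl)
              ; sym = λ { {c} {d} (k , c-d≡k) → ℤ.- k , λ a → ≡.trans (flip-difference (c a) (d a)) (cong ℤ.-_ (c-d≡k a)) }
              ; trans = λ {c} {d} {e} → ≈ᶜ-trans {c} {d} {e}
              }
            ; ∙-cong = λ { {c} {c′} {d} {d′} (k , c-c′≡k) (l , d-d′≡l) →
                k ℤ.+ l , λ a → ≡.trans (differences (c a) (d a) (c′ a) (d′ a)) (cong₂ ℤ._+_ (c-c′≡k a) (d-d′≡l a)) }
            }
          ; assoc = λ c d e → ≗⇒≈ᶜ λ a → ℤ.+-assoc (c a) (d a) (e a)
          }
        ; identity = (λ c → ≗⇒≈ᶜ λ a → ℤ.+-identityˡ (c a)) , (λ c → ≗⇒≈ᶜ λ a → ℤ.+-identityʳ (c a))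
        }
      ; comm = λ c d → ≗⇒≈ᶜ λ a → ℤ.+-comm (c a) (d a)
      }
    }

  ·ᶜ-congʳ : ∀ k {c d : Cyc p} → c ≈ᶜ d → (k ·ᶜ c) ≈ᶜ (k ·ᶜ d)
  ·ᶜ-congʳ k {c} {d} (l , c-d≡l) = k ℤ.* l , λ a → ≡.trans (scale-difference k (c a) (d a)) (cong (k ℤ.*_) (c-d≡l a))

  ·ᶜ-assoc : ∀ k l (c : Cyc p) → (k ·ᶜ (l ·ᶜ c)) ≈ᶜ ((k ℤ.* l) ·ᶜ c)
  ·ᶜ-assoc k l c = ≗⇒≈ᶜ {c = k ·ᶜ (l ·ᶜ c)} {(k ℤ.* l) ·ᶜ c} λ a → ≡.sym (ℤ.*-assoc k l (c a))

  open CommutativeMonoid Cyc-commutativeMonoid using (setoid; refl; ∙-congˡ; assoc; identityʳ)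
  open import Relation.Binary.Reasoning.Setoid setoid
  open CommutativeMonoidSum Cyc-commutativeMonoid public using (sum; sum-syntax)

  sum-cong : ∀ {n} {t u : Vector (Cyc p) n} → (∀ i → t i ≈ᶜ u i) → sum t ≈ᶜ sum u
  sum-cong = CommutativeMonoidSum.sum-cong-≋ Cyc-commutativeMonoid

  sum-at : ∀ {n} (t : Vector (Cyc p) n) a → sum t a ≡ CommutativeMonoidSum.sum ℤ.+-0-commutativeMonoid (λ i → t i a)
  sum-at {zero} t a = ≡.refl
  sum-at {suc n} t a = cong (ℤ._+_ (t 0F a)) (sum-at (tail t) a)

  sum-scale : ∀ {n} k (t : Vector (Cyc p) n) → sum (λ i → k ·ᶜ t i) ≈ᶜ (k ·ᶜ sum t)
  sum-scale k t = ≗⇒≈ᶜ (pointwise t)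
    where
    pointwise : ∀ {n} (t : Vector (Cyc p) n) → sum (λ i → k ·ᶜ t i) ≗ (k ·ᶜ sum t)
    pointwise {zero} t a = ≡.sym (ℤ.*-zeroʳ k)
    pointwise {suc n} t a = ≡.trans (cong (ℤ._+_ (k ℤ.* t 0F a)) (pointwise (tail t) a)) (≡.sym (ℤ.*-distribˡ-+ k _ _))

  sum-const : ∀ n (c : Cyc p) → sum {n} (λ _ → c) ≈ᶜ ((+ n) ·ᶜ c)
  sum-const n c = ≗⇒≈ᶜ (pointwise n)
    where
    pointwise : ∀ n → sum {n} (λ _ → c) ≗ ((+ n) ·ᶜ c)
    pointwise zero a = ≡.sym (ℤ.*-zeroˡ (c a))
    pointwise (suc n) a = ≡.trans (cong₂ ℤ._+_ (≡.sym (ℤ.*-identityˡ (c a))) (pointwise n a)) (≡.sym (ℤ.*-distribʳ-+ (c a) (+ 1) (+ n)))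

  sumᶜ-++ : (cs ds : List (Cyc p)) → sumᶜ (cs ++ ds) ≈ᶜ (sumᶜ cs +ᶜ sumᶜ ds)
  sumᶜ-++ [] ds = ≗⇒≈ᶜ λ a → ≡.sym (ℤ.+-identityˡ (sumᶜ ds a))
  sumᶜ-++ (c ∷ cs) ds = begin
    c +ᶜ sumᶜ (cs ++ ds)          ≈⟨ ∙-congˡ {c} (sumᶜ-++ cs ds) ⟩
    c +ᶜ (sumᶜ cs +ᶜ sumᶜ ds)     ≈⟨ assoc c (sumᶜ cs) (sumᶜ ds) ⟨
    (c +ᶜ sumᶜ cs) +ᶜ sumᶜ ds     ∎

  sumᶜ-concat : (css : List (List (Cyc p))) → sumᶜ (concat css) ≈ᶜ sumᶜ (List.map sumᶜ css)
  sumᶜ-concat [] = refl {zeroᶜ}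
  sumᶜ-concat (cs ∷ css) = begin
    sumᶜ (cs ++ concat css)                 ≈⟨ sumᶜ-++ cs (concat css) ⟩
    sumᶜ cs +ᶜ sumᶜ (concat css)            ≈⟨ ∙-congˡ {sumᶜ cs} (sumᶜ-concat css) ⟩
    sumᶜ cs +ᶜ sumᶜ (List.map sumᶜ css)     ∎

  sumᶜ-tabulate : ∀ {n} (t : Vector (Cyc p) n) → sumᶜ (List.tabulate t) ≡ sum t
  sumᶜ-tabulate {zero} t = ≡.refl
  sumᶜ-tabulate {suc n} t = cong (t 0F +ᶜ_) (sumᶜ-tabulate (tail t))

  ∑ⁿ : ∀ n → (Vec (Fin p) n → Cyc p) → Cyc p
  ∑ⁿ zero g = g []
  ∑ⁿ (suc n) g = ∑ⁿ n (λ v → sum (λ x → g (x ∷ v)))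

  ∑ⁿ-cong : ∀ n {g h : Vec (Fin p) n → Cyc p} → (∀ v → g v ≈ᶜ h v) → ∑ⁿ n g ≈ᶜ ∑ⁿ n h
  ∑ⁿ-cong zero g≈h = g≈h []
  ∑ⁿ-cong (suc n) g≈h = ∑ⁿ-cong n λ v → sum-cong λ x → g≈h (x ∷ v)

  ∑ⁿ-scale : ∀ n k (g : Vec (Fin p) n → Cyc p) → ∑ⁿ n (λ v → k ·ᶜ g v) ≈ᶜ (k ·ᶜ ∑ⁿ n g)
  ∑ⁿ-scale zero k g = refl {k ·ᶜ g []}
  ∑ⁿ-scale (suc n) k g = begin
    ∑ⁿ n (λ v → sum (λ x → k ·ᶜ g (x ∷ v)))   ≈⟨ ∑ⁿ-cong n (λ v → sum-scale k (λ x → g (x ∷ v))) ⟩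
    ∑ⁿ n (λ v → k ·ᶜ sum (λ x → g (x ∷ v)))   ≈⟨ ∑ⁿ-scale n k (λ v → sum (λ x → g (x ∷ v))) ⟩
    (k ·ᶜ ∑ⁿ (suc n) g)                         ∎

  sum-points : ∀ n (g : Vec (Fin p) n → Cyc p) → sumᶜ (List.map g (points p n)) ≈ᶜ ∑ⁿ n g
  sum-points zero g = identityʳ (g [])
  sum-points (suc n) g = begin
    sumᶜ (List.map g (List.concatMap fibre (points p n)))
      ≡⟨ cong sumᶜ (List.map-concatMap g fibre (points p n)) ⟩
    sumᶜ (concat (List.map (List.map g ∘ fibre) (points p n)))
      ≈⟨ sumᶜ-concat (List.map (List.map g ∘ fibre) (points p n)) ⟩
    sumᶜ (List.map sumᶜ (List.map (List.map g ∘ fibre) (points p n)))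
      ≡⟨ cong sumᶜ (≡.trans (≡.sym (List.map-∘ (points p n))) (List.map-cong fibre-sum (points p n))) ⟩
    sumᶜ (List.map (λ v → sum (λ x → g (x ∷ v))) (points p n))
      ≈⟨ sum-points n (λ v → sum (λ x → g (x ∷ v))) ⟩
    ∑ⁿ (suc n) g ∎
    where
    fibre : Vec (Fin p) n → List (Vec (Fin p) (suc n))
    fibre v = List.map (_∷ v) (allFin p)
    fibre-sum : ∀ v → sumᶜ (List.map g (fibre v)) ≡ sum (λ x → g (x ∷ v))
    fibre-sum v = ≡.trans (cong sumᶜ (≡.trans (≡.sym (List.map-∘ (allFin p))) (List.map-tabulate (λ x → x) (g ∘ (_∷ v)))))
                          (sumᶜ-tabulate (λ x → g (x ∷ v)))

module _ (p : ℕ) .{{_ : NonZero p}} (p-prime : Prime p) where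
  open Residues p p-prime
  open CommutativeMonoid (Cyc-commutativeMonoid {p}) using (setoid; sym; reflexive)
  open import Relation.Binary.Reasoning.Setoid setoid

  ePow-cong : ∀ {k l} → k % p ≡ l % p → ePow p k ≈ᶜ ePow p l
  ePow-cong {k} {l} k≡l = ≗⇒≈ᶜ {c = ePow p k} {ePow p l} λ a → cong (λ r → if does (r ℕ.≟ toℕ a) then + 1 else + 0) k≡l

  ePow-≡ : ∀ k a → k % p ≡ toℕ a → ePow p k a ≡ + 1
  ePow-≡ k a eq = cong (λ b → if b then + 1 else + 0) (dec-true (k % p ℕ.≟ toℕ a) eq)

  ePow-≢ : ∀ k a → k % p ≢ toℕ a → ePow p k a ≡ + 0
  ePow-≢ k a neq = cong (λ b → if b then + 1 else + 0) (dec-false (k % p ℕ.≟ toℕ a) neq)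

  affine-sum-vanishes : ∀ {d} r → p ∤ d → (∑[ x < p ] ePow p (toℕ x * d + r)) ≈ᶜ zeroᶜ
  affine-sum-vanishes {d} r p∤d = + 1 , λ b → ≡.trans (ℤ.+-identityʳ _) (coefficient b)
    where
    term : Fin p → Cyc p
    term x = ePow p (toℕ x * d + r)
    coefficient : ∀ b → sum term b ≡ + 1
    coefficient b = ≡.trans (sum-at term b)
      (≡.trans (sum-collapse ℤ.+-0-commutativeMonoid (λ x → term x b) x₀ miss) (ePow-≡ _ b hit))
      where
      preimage = residue-surjective (λ x → toℕ x * d + r) (affine-injective r p∤d) (toℕ b)
      x₀ = proj₁ preimage
      hit : (toℕ x₀ * d + r) % p ≡ toℕ b
      hit = ≡.trans (proj₂ preimage) (m<n⇒m%n≡m (toℕ<n b))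
      miss : ∀ x → x ≢ x₀ → term x b ≡ + 0
      miss x x≢x₀ = ePow-≢ _ b λ eq → x≢x₀ (affine-injective r p∤d (≡.trans eq (≡.sym hit)))

  pair-sum : ∀ c (h : Fin p → ℕ) a → p ∣ toℕ a + c →
    (∑[ x₂ < p ] ∑[ x₁ < p ] ePow p (toℕ x₁ * (toℕ x₂ + c) + h x₂)) ≈ᶜ ((+ p) ·ᶜ ePow p (h a))
  pair-sum c h a p∣a+c = begin
    sum inner                  ≈⟨ sum-collapse Cyc-commutativeMonoid inner a off-diagonal ⟩
    inner a                    ≈⟨ sum-cong {n = p} {t = λ x₁ → ePow p (toℕ x₁ * (toℕ a + c) + h a)} {u = λ _ → ePow p (h a)}
                                    (λ x₁ → ePow-cong (%-remove-+ˡ (h a) (∣n⇒∣m*n (toℕ x₁) p∣a+c))) ⟩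
    ∑[ _ < p ] ePow p (h a)    ≈⟨ sum-const p (ePow p (h a)) ⟩
    ((+ p) ·ᶜ ePow p (h a))    ∎
    where
    inner : Fin p → Cyc p
    inner x₂ = ∑[ x₁ < p ] ePow p (toℕ x₁ * (toℕ x₂ + c) + h x₂)
    off-diagonal : ∀ x₂ → x₂ ≢ a → inner x₂ ≈ᶜ zeroᶜ
    off-diagonal x₂ x₂≢a = affine-sum-vanishes (h x₂) λ p∣x₂+c → x₂≢a (negation-unique c p∣x₂+c p∣a+c)

  sum⁴-R2 : ∀ {m} (v : Vec (Fin p) (suc m)) →
    (∑[ x₄ < p ] ∑[ x₃ < p ] ∑[ x₂ < p ] ∑[ x₁ < p ] ePow p (R2 _ (x₁ ∷ x₂ ∷ x₃ ∷ x₄ ∷ v)))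
      ≈ᶜ ((+ (p ^ 2)) ·ᶜ ePow p (R2 _ v))
  sum⁴-R2 v = begin
    (∑[ x₄ < p ] ∑[ x₃ < p ] ∑[ x₂ < p ] ∑[ x₁ < p ] ePow p (R2 _ (x₁ ∷ x₂ ∷ x₃ ∷ x₄ ∷ v)))
      ≈⟨ sum-cong (λ x₄ → sum-cong λ x₃ → sum-cong λ x₂ → sum-cong λ x₁ →
           reflexive (cong (ePow p) (R2-peel x₁ x₂ x₃ x₄ v))) ⟩
    (∑[ x₄ < p ] ∑[ x₃ < p ] ∑[ x₂ < p ] ∑[ x₁ < p ] ePow p (toℕ x₁ * (toℕ x₂ + l) + free-of-x₁ x₃ x₄ x₂))
      ≈⟨ sum-cong (λ x₄ → sum-cong λ x₃ → pair-sum l (free-of-x₁ x₃ x₄) −l p∣−l+l) ⟩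
    (∑[ x₄ < p ] ∑[ x₃ < p ] ((+ p) ·ᶜ ePow p (toℕ x₃ * (toℕ x₄ + toℕ −l) + free-of-x₃ x₄)))
      ≈⟨ sum-cong (λ x₄ → sum-scale {n = p} (+ p) λ x₃ → ePow p (toℕ x₃ * (toℕ x₄ + toℕ −l) + free-of-x₃ x₄)) ⟩
    (∑[ x₄ < p ] ((+ p) ·ᶜ (∑[ x₃ < p ] ePow p (toℕ x₃ * (toℕ x₄ + toℕ −l) + free-of-x₃ x₄))))
      ≈⟨ sum-scale {n = p} (+ p) (λ x₄ → ∑[ x₃ < p ] ePow p (toℕ x₃ * (toℕ x₄ + toℕ −l) + free-of-x₃ x₄)) ⟩
    ((+ p) ·ᶜ (∑[ x₄ < p ] ∑[ x₃ < p ] ePow p (toℕ x₃ * (toℕ x₄ + toℕ −l) + free-of-x₃ x₄)))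
      ≈⟨ ·ᶜ-congʳ (+ p) (pair-sum (toℕ −l) free-of-x₃ (last v) (subst (p ∣_) (ℕ.+-comm (toℕ −l) l) p∣−l+l)) ⟩
    ((+ p) ·ᶜ ((+ p) ·ᶜ ePow p (free-of-x₃ (last v))))
      ≈⟨ ·ᶜ-assoc (+ p) (+ p) (ePow p (free-of-x₃ (last v))) ⟩
    (((+ p) ℤ.* (+ p)) ·ᶜ ePow p (free-of-x₃ (last v)))
      ≡⟨ cong₂ _·ᶜ_ square (cong (ePow p) (≡.sym (R2≡last*head+chain v))) ⟩
    ((+ (p ^ 2)) ·ᶜ ePow p (R2 _ v))
      ∎
    where
    l = toℕ (last v)
    free-of-x₃ : Fin p → ℕ
    free-of-x₃ x₄ = toℕ x₄ * toℕ (Vec.head v) + chain v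
    free-of-x₁ : Fin p → Fin p → Fin p → ℕ
    free-of-x₁ x₃ x₄ x₂ = toℕ x₃ * (toℕ x₄ + toℕ x₂) + free-of-x₃ x₄
    −l = proj₁ (negation l)
    p∣−l+l = proj₂ (negation l)
    square : (+ p) ℤ.* (+ p) ≡ + (p ^ 2)
    square = ≡.trans (≡.sym (ℤ.pos-* p p)) (cong (λ k → + (p * k)) (≡.sym (ℕ.*-identityʳ p)))

  S-recurrence : ∀ m → S p (4 + suc m) (R2 (4 + suc m)) ≈ᶜ ((+ (p ^ 2)) ·ᶜ S p (suc m) (R2 (suc m)))
  S-recurrence m = begin
    S p (4 + n) (R2 _)                              ≈⟨ sum-points (4 + n) (ePow p ∘ R2 _) ⟩
    ∑ⁿ (4 + n) (ePow p ∘ R2 _)                      ≈⟨ ∑ⁿ-cong n {g = first-four-summed} sum⁴-R2 ⟩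
    ∑ⁿ n (λ v → (+ (p ^ 2)) ·ᶜ ePow p (R2 _ v))     ≈⟨ ∑ⁿ-scale n (+ (p ^ 2)) (ePow p ∘ R2 _) ⟩
    ((+ (p ^ 2)) ·ᶜ ∑ⁿ n (ePow p ∘ R2 _))            ≈⟨ ·ᶜ-congʳ (+ (p ^ 2)) (sum-points n (ePow p ∘ R2 _)) ⟨
    ((+ (p ^ 2)) ·ᶜ S p n (R2 _))                    ∎
    where
    n = suc m
    first-four-summed : Vec (Fin p) n → Cyc p
    first-four-summed v = ∑[ x₄ < p ] ∑[ x₃ < p ] ∑[ x₂ < p ] ∑[ x₁ < p ] ePow p (R2 _ (x₁ ∷ x₂ ∷ x₃ ∷ x₄ ∷ v))

theorem3p5 : (p : ℕ) .{{_ : NonZero p}} → Prime p → 2 < p →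
    (n : ℕ) → 3 ≤ n →
    S p (n + 4) (R2 (n + 4)) ≈ᶜ ((+ (p ^ 2)) ·ᶜ S p n (R2 n))
theorem3p5 p _ _ zero ()
theorem3p5 p p-prime _ (suc m) _ =
  subst (λ k → S p k (R2 k) ≈ᶜ ((+ (p ^ 2)) ·ᶜ S p (suc m) (R2 (suc m))))
    (ℕ.+-comm 4 (suc m)) (S-recurrence p p-prime m)
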